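{- Define the unitary convolution of arithmetic functions by $(a\oplus b)(n)=\sum_{d\mid n,\ \gcd(d,n/d)=1}a(d)b(n/d)$. Let $\mu^*(n)=(-1)^{\omega(n)}$, where $\omega(n)$ is the number of distinct prime factors of $n$, and let the unitary totient be $\varphi^*=\mu^*\oplus n$ (so $\varphi^*(p^e)=p^e-1$ for primes $p$, $e\ge1$, and $\varphi^*$ is multiplicative). For $k\ge1$ let the unitary Jordan function be $J_k^*=\mu^*\oplus n^k$. Then, with $\varphi$ Euler's totient, $\sigma_0(n)$ the number of divisors of $n$ and $\star$ the Dirichlet convolution $(f\star g)(n)=\sum_{d\mid n}f(d)g(n/d)$, $$\varphi^*\star\varphi=\sigma_0\,\varphi\quad\text{(pointwise product on the right)},$$ and for every $k\ge1$ and every $n\ge1$, $J_k^*(n)=\varphi^*(n^k)$. -}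

module Defs where

open import Data.Nat as ℕ using (ℕ; zero; suc; _∸_)
open import Data.Nat.Divisibility using (_∣_; _∣?_)
open import Data.Nat.GCD using (gcd)
open import Data.Nat.Primality using (Prime; prime?)
open import Data.Nat.Coprimality using (Coprime; coprime?)
open import Data.Integer as ℤ using (ℤ; +_; -[1+_])
open import Data.List using (List; map; filter; length; sum; upTo)
open import Data.Product using (_×_)
open import Relation.Nullary.Decidable using (_×-dec_)

-- Arithmetic functions: ℕ → ℤ ; only values at n ≥ 1 are meaningful.
ArithFun : Set
ArithFun = ℕ → ℤ

range1 : ℕ → List ℕ
range1 n = map suc (upTo n)

divisors : ℕ → List ℕ
divisors n = filter (_∣? n) (range1 n)

quot : ℕ → ℕ → ℕ
quot n d = ℕ._/_ n (suc (d ∸ 1))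

unitaryDivisors : ℕ → List ℕ
unitaryDivisors n = filter (λ d → (d ∣? n) ×-dec coprime? d (quot n d)) (range1 n)

sumℤ : List ℤ → ℤ
sumℤ = Data.List.foldr ℤ._+_ (+ 0)
  where import Data.List

_⋆_ : ArithFun → ArithFun → ArithFun
(f ⋆ g) n = sumℤ (map (λ d → f d ℤ.* g (quot n d)) (divisors n))

_⊕_ : ArithFun → ArithFun → ArithFun
(a ⊕ b) n = sumℤ (map (λ d → a d ℤ.* b (quot n d)) (unitaryDivisors n))

ω : ℕ → ℕ
ω n = length (filter (λ p → prime? p ×-dec (p ∣? n)) (range1 n))

μ* : ArithFun
μ* n = (ℤ.- (+ 1)) ℤ.^ ω n

idPow : ℕ → ArithFun
idPow k n = + (n ℕ.^ k)

φ* : ArithFun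
φ* = μ* ⊕ idPow 1

J* : ℕ → ArithFun
J* k = μ* ⊕ idPow k

φ : ArithFun
φ n = + length (filter (λ m → coprime? m n) (range1 n))

σ₀ : ArithFun
σ₀ n = + length (divisors n)

-- All functions involved are multiplicative, and multiplicative functions are
-- determined by their values at prime powers, so each identity reduces to a
-- computation at pᵉ.  Finally φ*(d) = d - 1 + [d = 1]
-- on divisors of pᵉ turns (φ* ⋆ φ)(pᵉ) into (id ⋆ φ)(pᵉ) - pᵉ + φ(pᵉ)
-- = (e + 1)·φ(pᵉ) = σ₀(pᵉ)·φ(pᵉ), the first identity.
module Submission where

open import Defs
open import Data.Nat as ℕ using (ℕ; zero; suc; _+_; _*_; _∸_; _^_; _≤_; _<_; _≥_; z≤n; s≤s)
import Data.Nat.Properties as ℕP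
open import Data.Nat.Divisibility
open import Data.Nat.DivMod using (m*n/n≡m; n/1≡n)
open import Data.Nat.GCD using (gcd; gcd[m,n]∣m; gcd[m,n]∣n; gcd-greatest; c*gcd[m,n]≡gcd[cm,cn])
open import Data.Nat.Coprimality as Coprime using (Coprime; coprime?)
open import Data.Nat.Primality using (Prime; prime?; euclidsLemma; prime⇒irreducible; prime⇒nonTrivial; prime⇒nonZero)
open import Data.Nat.Primality.Factorisation using (factorise)
open import Data.Nat.ListAction using (product)
open import Data.Nat.Induction using (<-rec)
open import Data.Nat.Tactic.RingSolver using (solve-∀)
open import Data.Integer as ℤ using (ℤ; +_; -[1+_]) renaming (_+_ to _+ᶻ_; _*_ to _*ᶻ_; _-_ to _-ᶻ_)
import Data.Integer.Properties as ℤP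
import Data.Integer.Tactic.RingSolver as ℤSolver
open import Algebra.Properties.CommutativeSemigroup ℕP.*-commutativeSemigroup using () renaming (interchange to *-interchange)
open import Algebra.Properties.CommutativeSemigroup ℤP.*-commutativeSemigroup using () renaming (interchange to *ᶻ-interchange)
open import Algebra.Properties.CommutativeSemigroup ℤP.+-commutativeSemigroup using () renaming (interchange to +ᶻ-interchange)
open import Data.List using (List; []; _∷_; [_]; map; filter; length; _++_; cartesianProduct; upTo)
import Data.List.Properties as LP
open import Data.List.Membership.Propositional using (_∈_)
open import Data.List.Membership.Propositional.Properties
open import Data.List.Membership.Propositional.Properties.WithK using (unique∧set⇒bag)
open import Data.List.Relation.Unary.Any using (here; there)
open import Data.List.Relation.Unary.All as All using (All; []; _∷_)
open import Data.List.Relation.Unary.AllPairs using ([]; _∷_)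
open import Data.List.Relation.Unary.Unique.Propositional using (Unique)
import Data.List.Relation.Unary.Unique.Propositional.Properties as Unique
open import Data.List.Relation.Binary.Permutation.Propositional using (_↭_; prep; swap) renaming (refl to ↭-refl; trans to ↭-trans)
import Data.List.Relation.Binary.Permutation.Propositional.Properties as Perm
open import Data.List.Relation.Binary.BagAndSetEquality using (∼bag⇒↭)
open import Data.Product using (∃; _×_; _,_; proj₁; proj₂)
open import Data.Sum as Sum using (_⊎_; inj₁; inj₂)
open import Data.Empty using (⊥; ⊥-elim)
open import Function using (_∘_; _⇔_; mk⇔)
open import Relation.Binary.PropositionalEquality hiding ([_])
open import Relation.Binary.Definitions using (tri<; tri≈; tri>)
open import Relation.Nullary using (¬_; Dec; yes; no; _×-dec_)
open import Relation.Unary using (Decidable; _≐_)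

variable
  A B : Set

Σℤ : (A → ℤ) → List A → ℤ
Σℤ f xs = sumℤ (map f xs)

Σ-cong : {f g : A → ℤ} (xs : List A) → (∀ {x} → x ∈ xs → f x ≡ g x) → Σℤ f xs ≡ Σℤ g xs
Σ-cong []       eq = refl
Σ-cong (x ∷ xs) eq = cong₂ _+ᶻ_ (eq (here refl)) (Σ-cong xs (eq ∘ there))

Σ-zero : {f : A → ℤ} (xs : List A) → (∀ {x} → x ∈ xs → f x ≡ + 0) → Σℤ f xs ≡ + 0
Σ-zero []       eq = refl
Σ-zero (x ∷ xs) eq = cong₂ _+ᶻ_ (eq (here refl)) (Σ-zero xs (eq ∘ there))

Σ-const : (c : ℤ) (xs : List A) → Σℤ (λ _ → c) xs ≡ + length xs *ᶻ c
Σ-const c []       = sym (ℤP.*-zeroˡ c)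
Σ-const c (x ∷ xs) = begin
  c +ᶻ Σℤ (λ _ → c) xs          ≡⟨ cong (c +ᶻ_) (Σ-const c xs) ⟩
  c +ᶻ + length xs *ᶻ c         ≡⟨ sym (ℤP.suc-* (+ length xs) c) ⟩
  + suc (length xs) *ᶻ c        ∎
  where open ≡-Reasoning

Σ-one : (xs : List A) → Σℤ (λ _ → + 1) xs ≡ + length xs
Σ-one xs = trans (Σ-const (+ 1) xs) (ℤP.*-identityʳ (+ length xs))

Σ-++ : (f : A → ℤ) (xs ys : List A) → Σℤ f (xs ++ ys) ≡ Σℤ f xs +ᶻ Σℤ f ys
Σ-++ f []       ys = sym (ℤP.+-identityˡ _)
Σ-++ f (x ∷ xs) ys = trans (cong (f x +ᶻ_) (Σ-++ f xs ys)) (sym (ℤP.+-assoc (f x) _ _))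

Σ-+ : (f g : A → ℤ) (xs : List A) → Σℤ (λ x → f x +ᶻ g x) xs ≡ Σℤ f xs +ᶻ Σℤ g xs
Σ-+ f g []       = refl
Σ-+ f g (x ∷ xs) = trans (cong (f x +ᶻ g x +ᶻ_) (Σ-+ f g xs)) (+ᶻ-interchange (f x) (g x) _ _)

Σ-- : (f g : A → ℤ) (xs : List A) → Σℤ (λ x → f x -ᶻ g x) xs ≡ Σℤ f xs -ᶻ Σℤ g xs
Σ-- f g []       = refl
Σ-- f g (x ∷ xs) = trans (cong (f x -ᶻ g x +ᶻ_) (Σ-- f g xs)) (regroup (f x) (g x) _ _)
  where
  regroup : ∀ a b c d → (a -ᶻ b) +ᶻ (c -ᶻ d) ≡ (a +ᶻ c) -ᶻ (b +ᶻ d)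
  regroup = ℤSolver.solve-∀

Σ-*ˡ : (c : ℤ) (f : A → ℤ) (xs : List A) → Σℤ (λ x → c *ᶻ f x) xs ≡ c *ᶻ Σℤ f xs
Σ-*ˡ c f []       = sym (ℤP.*-zeroʳ c)
Σ-*ˡ c f (x ∷ xs) = trans (cong (c *ᶻ f x +ᶻ_) (Σ-*ˡ c f xs)) (sym (ℤP.*-distribˡ-+ c (f x) _))

Σ-*ʳ : (c : ℤ) (f : A → ℤ) (xs : List A) → Σℤ (λ x → f x *ᶻ c) xs ≡ Σℤ f xs *ᶻ c
Σ-*ʳ c f xs = begin
  Σℤ (λ x → f x *ᶻ c) xs  ≡⟨ Σ-cong xs (λ {x} _ → ℤP.*-comm (f x) c) ⟩
  Σℤ (λ x → c *ᶻ f x) xs  ≡⟨ Σ-*ˡ c f xs ⟩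
  c *ᶻ Σℤ f xs            ≡⟨ ℤP.*-comm c _ ⟩
  Σℤ f xs *ᶻ c            ∎
  where open ≡-Reasoning

Σ-map : (f : B → ℤ) (h : A → B) (xs : List A) → Σℤ f (map h xs) ≡ Σℤ (f ∘ h) xs
Σ-map f h xs = cong sumℤ (sym (LP.map-∘ xs))

Σ-product : (f : A → ℤ) (g : B → ℤ) (xs : List A) (ys : List B) →
            Σℤ f xs *ᶻ Σℤ g ys ≡ Σℤ (λ x → Σℤ (λ y → f x *ᶻ g y) ys) xs
Σ-product f g xs ys = begin
  Σℤ f xs *ᶻ Σℤ g ys                       ≡⟨ Σ-*ʳ (Σℤ g ys) f xs ⟨
  Σℤ (λ x → f x *ᶻ Σℤ g ys) xs             ≡⟨ Σ-cong xs (λ {x} _ → Σ-*ˡ (f x) g ys) ⟨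
  Σℤ (λ x → Σℤ (λ y → f x *ᶻ g y) ys) xs   ∎
  where open ≡-Reasoning

Σ-swap : (F : A → B → ℤ) (xs : List A) (ys : List B) →
         Σℤ (λ x → Σℤ (F x) ys) xs ≡ Σℤ (λ y → Σℤ (λ x → F x y) xs) ys
Σ-swap F []       ys = sym (Σ-zero ys (λ _ → refl))
Σ-swap F (x ∷ xs) ys = trans (cong (Σℤ (F x) ys +ᶻ_) (Σ-swap F xs ys))
                             (sym (Σ-+ (F x) (λ y → Σℤ (λ x′ → F x′ y) xs) ys))

Σ-pairs : (F : A × B → ℤ) (xs : List A) (ys : List B) →
          Σℤ F (cartesianProduct xs ys) ≡ Σℤ (λ x → Σℤ (λ y → F (x , y)) ys) xs
Σ-pairs F []       ys = refl
Σ-pairs F (x ∷ xs) ys = trans (Σ-++ F (map (x ,_) ys) (cartesianProduct xs ys))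
                              (cong₂ _+ᶻ_ (Σ-map F (x ,_) ys) (Σ-pairs F xs ys))

Σ-single : (f : A → ℤ) {y : A} {xs : List A} → Unique xs → y ∈ xs →
           (∀ {x} → x ∈ xs → x ≢ y → f x ≡ + 0) → Σℤ f xs ≡ f y
Σ-single f {xs = _ ∷ xs} (y≢ ∷ _) (here refl) vanish =
  trans (cong (f _ +ᶻ_) (Σ-zero xs (λ x∈ → vanish (there x∈) (≢-sym (All.lookup y≢ x∈)))))
        (ℤP.+-identityʳ _)
Σ-single f {xs = x ∷ xs} (x≢ ∷ u) (there y∈) vanish =
  trans (cong₂ _+ᶻ_ (vanish (here refl) (All.lookup x≢ y∈)) (Σ-single f u y∈ (vanish ∘ there)))
        (ℤP.+-identityˡ _)

Σ-↭ : (f : A → ℤ) {xs ys : List A} → xs ↭ ys → Σℤ f xs ≡ Σℤ f ys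
Σ-↭ f p = sum↭ (Perm.map⁺ f p)
  where
  sum↭ : {xs ys : List ℤ} → xs ↭ ys → sumℤ xs ≡ sumℤ ys
  sum↭ ↭-refl          = refl
  sum↭ (prep x p)      = cong (x +ᶻ_) (sum↭ p)
  sum↭ (swap x y p)    = trans (sym (ℤP.+-assoc x y _))
    (trans (cong₂ _+ᶻ_ (ℤP.+-comm x y) (sum↭ p)) (ℤP.+-assoc y x _))
  sum↭ (↭-trans p q)   = trans (sum↭ p) (sum↭ q)

Σ-sameElements : (f : A → ℤ) {xs ys : List A} → Unique xs → Unique ys →
                 (∀ {x} → x ∈ xs ⇔ x ∈ ys) → Σℤ f xs ≡ Σℤ f ys
Σ-sameElements f ux uy same = Σ-↭ f (∼bag⇒↭ (unique∧set⇒bag ux uy same))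

unique-map : (h : A → B) (xs : List A) → Unique xs →
             (∀ {x y} → x ∈ xs → y ∈ xs → h x ≡ h y → x ≡ y) → Unique (map h xs)
unique-map h []       []       inj = []
unique-map h (x ∷ xs) (x≢ ∷ u) inj =
  headDistinct xs x≢ (λ y∈ → inj (here refl) (there y∈)) ∷ unique-map h xs u (λ p q → inj (there p) (there q))
  where
  headDistinct : ∀ ys → All (x ≢_) ys → (∀ {y} → y ∈ ys → h x ≡ h y → x ≡ y) → All (h x ≢_) (map h ys)
  headDistinct []       []         _   = []
  headDistinct (y ∷ ys) (x≢y ∷ ps) inj′ = (x≢y ∘ inj′ (here refl)) ∷ headDistinct ys ps (inj′ ∘ there)

Σ-reindex : (xs : List A) (ys : List B) (h : A → B) → Unique xs → Unique ys →
            (∀ {x} → x ∈ xs → h x ∈ ys) → (∀ {y} → y ∈ ys → ∃ λ x → x ∈ xs × h x ≡ y) →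
            (∀ {x x′} → x ∈ xs → x′ ∈ xs → h x ≡ h x′ → x ≡ x′) → (f : B → ℤ) →
            Σℤ (f ∘ h) xs ≡ Σℤ f ys
Σ-reindex xs ys h ux uy into onto inj f =
  trans (sym (Σ-map f h xs)) (Σ-sameElements f (unique-map h xs ux inj) uy (mk⇔ to from))
  where
  to : ∀ {y} → y ∈ map h xs → y ∈ ys
  to y∈ with ∈-map⁻ h y∈
  ... | x , x∈ , refl = into x∈
  from : ∀ {y} → y ∈ ys → y ∈ map h xs
  from y∈ with onto y∈
  ... | x , x∈ , refl = ∈-map⁺ h x∈

ind : {P : Set} → Dec P → ℤ
ind (yes _) = + 1
ind (no _)  = + 0

ind-yes : {P : Set} (P? : Dec P) → P → ind P? ≡ + 1
ind-yes (yes _) _ = refl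
ind-yes (no ¬p) p = ⊥-elim (¬p p)

ind-no : {P : Set} (P? : Dec P) → ¬ P → ind P? ≡ + 0
ind-no (yes p) ¬p = ⊥-elim (¬p p)
ind-no (no _)  _  = refl

Σ-ind : {P : A → Set} (P? : Decidable P) (xs : List A) → Σℤ (ind ∘ P?) xs ≡ + length (filter P? xs)
Σ-ind P? []       = refl
Σ-ind P? (x ∷ xs) with P? x
... | yes _ = trans (cong (+ 1 +ᶻ_) (Σ-ind P? xs)) (ℤP.pos-+ 1 _)
... | no _  = trans (ℤP.+-identityˡ _) (Σ-ind P? xs)

*-pos : ∀ {a b} → 1 ≤ a → 1 ≤ b → 1 ≤ a * b
*-pos = ℕP.*-mono-≤

^-pos : ∀ {a} k → 1 ≤ a → 1 ≤ a ^ k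
^-pos zero    _   = s≤s z≤n
^-pos (suc k) 1≤a = *-pos 1≤a (^-pos k 1≤a)

∣⇒pos : ∀ {d n} → 1 ≤ n → d ∣ n → 1 ≤ d
∣⇒pos {zero}  1≤n d∣n with refl ← 0∣⇒≡0 d∣n = 1≤n
∣⇒pos {suc d} _   _   = s≤s z≤n

∣∧≢⇒< : ∀ {d n} → 1 ≤ n → d ∣ n → d ≢ n → d < n
∣∧≢⇒< {n = suc _} _ d∣n d≢n = ℕP.≤∧≢⇒< (∣⇒≤ d∣n) d≢n

*-^ : ∀ a b k → (a * b) ^ k ≡ a ^ k * b ^ k
*-^ a b zero    = refl
*-^ a b (suc k) = trans (cong ((a * b) *_) (*-^ a b k)) (*-interchange a b (a ^ k) (b ^ k))

quot-unique : ∀ {n d q} → 1 ≤ d → n ≡ q * d → quot n d ≡ q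
quot-unique {d = suc d} {q} _ refl = m*n/n≡m q (suc d)

quot-self : ∀ {n} → 1 ≤ n → quot n n ≡ 1
quot-self {n} 1≤n = quot-unique 1≤n (sym (ℕP.*-identityˡ n))

quot-* : ∀ {n d} → 1 ≤ d → d ∣ n → quot n d * d ≡ n
quot-* {n} {d} 1≤d (divides q eq) = trans (cong (_* d) (quot-unique {n} {d} {q} 1≤d eq)) (sym eq)

quot-∣ : ∀ {n d} → 1 ≤ d → d ∣ n → quot n d ∣ n
quot-∣ {n} {d} 1≤d d∣n = divides d (sym (trans (ℕP.*-comm d _) (quot-* 1≤d d∣n)))

quot-pos : ∀ {n d} → 1 ≤ n → 1 ≤ d → d ∣ n → 1 ≤ quot n d
quot-pos 1≤n 1≤d d∣n = ∣⇒pos 1≤n (quot-∣ 1≤d d∣n)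

quot-quot : ∀ {n d} → 1 ≤ n → 1 ≤ d → d ∣ n → quot n (quot n d) ≡ d
quot-quot {n} {d} 1≤n 1≤d d∣n =
  quot-unique (quot-pos 1≤n 1≤d d∣n) (sym (trans (ℕP.*-comm d _) (quot-* 1≤d d∣n)))

quot-mul : ∀ {a b d₁ d₂} → 1 ≤ d₁ → 1 ≤ d₂ → d₁ ∣ a → d₂ ∣ b →
           quot (a * b) (d₁ * d₂) ≡ quot a d₁ * quot b d₂
quot-mul {d₁ = d₁} {d₂} 1≤d₁ 1≤d₂ (divides q₁ refl) (divides q₂ refl) =
  trans (quot-unique {q = q₁ * q₂} (*-pos 1≤d₁ 1≤d₂) (*-interchange q₁ d₁ q₂ d₂))
        (sym (cong₂ _*_ (quot-unique {q₁ * d₁} {d₁} {q₁} 1≤d₁ refl) (quot-unique {q₂ * d₂} {d₂} {q₂} 1≤d₂ refl)))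

∈range1⁻ : ∀ {x n} → x ∈ range1 n → 1 ≤ x × x ≤ n
∈range1⁻ x∈ with ∈-map⁻ suc x∈
... | i , i∈ , refl = s≤s z≤n , ∈-upTo⁻ i∈

∈range1⁺ : ∀ {x n} → 1 ≤ x → x ≤ n → x ∈ range1 n
∈range1⁺ {suc x} _ x≤n = ∈-map⁺ suc (∈-upTo⁺ x≤n)

unique-range1 : ∀ n → Unique (range1 n)
unique-range1 n = Unique.map⁺ ℕP.suc-injective (Unique.upTo⁺ n)

range1-∷ʳ : ∀ n → range1 (suc n) ≡ range1 n ++ [ suc n ]
range1-∷ʳ n = trans (cong (map suc) (sym (LP.upTo-∷ʳ n))) (LP.map-++ suc (upTo n) [ n ])

∈divisors⁻ : ∀ {d n} → d ∈ divisors n → d ∣ n × 1 ≤ d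
∈divisors⁻ {n = n} d∈ with ∈-filter⁻ (_∣? n) {xs = range1 n} d∈
... | d∈range , d∣n = d∣n , proj₁ (∈range1⁻ d∈range)

∈divisors⁺ : ∀ {d n} → 1 ≤ n → d ∣ n → d ∈ divisors n
∈divisors⁺ {n = suc n} 1≤n d∣n = ∈-filter⁺ (_∣? suc n) (∈range1⁺ (∣⇒pos 1≤n d∣n) (∣⇒≤ d∣n)) d∣n

unique-divisors : ∀ n → Unique (divisors n)
unique-divisors n = Unique.filter⁺ (_∣? n) (unique-range1 n)

unitary? : ∀ n → Decidable (λ d → d ∣ n × Coprime d (quot n d))
unitary? n d = (d ∣? n) ×-dec coprime? d (quot n d)

∈unitary⁻ : ∀ {d n} → d ∈ unitaryDivisors n → d ∣ n × Coprime d (quot n d) × 1 ≤ d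
∈unitary⁻ {n = n} d∈ with ∈-filter⁻ (unitary? n) {xs = range1 n} d∈
... | d∈range , (d∣n , coprime) = d∣n , coprime , proj₁ (∈range1⁻ d∈range)

∈unitary⁺ : ∀ {d n} → 1 ≤ n → d ∣ n → Coprime d (quot n d) → d ∈ unitaryDivisors n
∈unitary⁺ {n = suc n} 1≤n d∣n coprime =
  ∈-filter⁺ (unitary? (suc n)) (∈range1⁺ (∣⇒pos 1≤n d∣n) (∣⇒≤ d∣n)) (d∣n , coprime)

unique-unitary : ∀ n → Unique (unitaryDivisors n)
unique-unitary n = Unique.filter⁺ (unitary? n) (unique-range1 n)

coprime-∣ˡ : ∀ {a b c} → Coprime a b → c ∣ a → Coprime c b
coprime-∣ˡ a⊥b c∣a (x∣c , x∣b) = a⊥b (∣-trans x∣c c∣a , x∣b)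

coprime-∣ʳ : ∀ {a b c} → Coprime a b → c ∣ b → Coprime a c
coprime-∣ʳ a⊥b c∣b (x∣a , x∣c) = a⊥b (x∣a , ∣-trans x∣c c∣b)

coprime-∣ : ∀ {a b c d} → Coprime a b → c ∣ a → d ∣ b → Coprime c d
coprime-∣ a⊥b c∣a d∣b = coprime-∣ʳ (coprime-∣ˡ a⊥b c∣a) d∣b

coprime-*ˡ : ∀ {a b c} → Coprime a c → Coprime b c → Coprime (a * b) c
coprime-*ˡ {a} {b} a⊥c b⊥c {x} (x∣ab , x∣c) = b⊥c (Coprime.coprime-divisor x⊥a x∣ab , x∣c)
  where
  x⊥a : Coprime x a
  x⊥a (y∣x , y∣a) = a⊥c (y∣a , ∣-trans y∣x x∣c)

coprime-*ʳ : ∀ {a b c} → Coprime a b → Coprime a c → Coprime a (b * c)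
coprime-*ʳ a⊥b a⊥c = Coprime.sym (coprime-*ˡ (Coprime.sym a⊥b) (Coprime.sym a⊥c))

coprime-^ˡ : ∀ {a b} k → Coprime a b → Coprime (a ^ k) b
coprime-^ˡ zero    _   = Coprime.1-coprimeTo _
coprime-^ˡ (suc k) a⊥b = coprime-*ˡ a⊥b (coprime-^ˡ k a⊥b)

coprime-^ : ∀ {a b} k → Coprime a b → Coprime (a ^ k) (b ^ k)
coprime-^ k a⊥b = Coprime.sym (coprime-^ˡ k (Coprime.sym (coprime-^ˡ k a⊥b)))

coprime⇒*∣ : ∀ {m n x} → Coprime m n → m ∣ x → n ∣ x → m * n ∣ x
coprime⇒*∣ {m} {n} m⊥n (divides k refl) n∣km
  with divides j refl ← Coprime.coprime-divisor (Coprime.sym m⊥n) (subst (n ∣_) (ℕP.*-comm k m) n∣km)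
  = divides j (trans (ℕP.*-assoc j n m) (cong (j *_) (ℕP.*-comm n m)))

gcd-split : ∀ {a b d} → Coprime a b → d ∣ a * b → gcd d a * gcd d b ≡ d
gcd-split {a} {b} {d} a⊥b d∣ab = ∣-antisym product∣d d∣product
  where
  product∣d : gcd d a * gcd d b ∣ d
  product∣d = coprime⇒*∣ (coprime-∣ a⊥b (gcd[m,n]∣n d a) (gcd[m,n]∣n d b)) (gcd[m,n]∣m d a) (gcd[m,n]∣m d b)
  d∣b·gcd : d ∣ b * gcd d a
  d∣b·gcd = subst (d ∣_) (sym (c*gcd[m,n]≡gcd[cm,cn] b d a))
              (gcd-greatest (n∣m*n b) (subst (d ∣_) (ℕP.*-comm a b) d∣ab))
  d∣product : d ∣ gcd d a * gcd d b
  d∣product = subst (d ∣_) (sym (c*gcd[m,n]≡gcd[cm,cn] (gcd d a) d b))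
                (gcd-greatest (n∣m*n (gcd d a)) (subst (d ∣_) (ℕP.*-comm b (gcd d a)) d∣b·gcd))

factor-unique : ∀ {a b d₁ d₂ e₁ e₂} → Coprime a b → d₁ ∣ a → e₁ ∣ a → d₂ ∣ b → e₂ ∣ b →
                d₁ * d₂ ≡ e₁ * e₂ → d₁ ≡ e₁ × d₂ ≡ e₂
factor-unique {d₁ = d₁} {d₂} {e₁} {e₂} a⊥b d₁∣a e₁∣a d₂∣b e₂∣b eq =
  ∣-antisym (cancel (coprime-∣ a⊥b d₁∣a e₂∣b) (subst (d₁ ∣_) (trans eq (ℕP.*-comm e₁ e₂)) (m∣m*n d₂)))
            (cancel (coprime-∣ a⊥b e₁∣a d₂∣b) (subst (e₁ ∣_) (trans (sym eq) (ℕP.*-comm d₁ d₂)) (m∣m*n e₂))) ,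
  ∣-antisym (cancel (Coprime.sym (coprime-∣ a⊥b e₁∣a d₂∣b)) (subst (d₂ ∣_) eq (n∣m*n d₁)))
            (cancel (Coprime.sym (coprime-∣ a⊥b d₁∣a e₂∣b)) (subst (e₂ ∣_) (sym eq) (n∣m*n e₁)))
  where
  cancel = Coprime.coprime-divisor

record Multiplicative (f : ArithFun) : Set where
  field
    one : f 1 ≡ + 1
    mul : ∀ {a b} → 1 ≤ a → 1 ≤ b → Coprime a b → f (a * b) ≡ f a *ᶻ f b

open Multiplicative

record DivisorSystem (D : ℕ → List ℕ) : Set where
  field
    unique   : ∀ n → Unique (D n)
    member-∣ : ∀ {d n} → d ∈ D n → d ∣ n
    at-one   : D 1 ≡ [ 1 ]
    combine  : ∀ {a b d₁ d₂} → 1 ≤ a → 1 ≤ b → Coprime a b →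
               d₁ ∈ D a → d₂ ∈ D b → d₁ * d₂ ∈ D (a * b)
    restrict : ∀ {a b d} → 1 ≤ a → 1 ≤ b → Coprime a b →
               d ∈ D (a * b) → gcd d a ∈ D a × gcd d b ∈ D b

  Σ-split : ∀ {a b} → 1 ≤ a → 1 ≤ b → Coprime a b → (F : ℕ → ℤ) →
            Σℤ F (D (a * b)) ≡ Σℤ (λ d₁ → Σℤ (λ d₂ → F (d₁ * d₂)) (D b)) (D a)
  Σ-split {a} {b} 1≤a 1≤b a⊥b F =
    trans (sym (Σ-reindex (cartesianProduct (D a) (D b)) (D (a * b)) multiply
                          (Unique.cartesianProduct⁺ (unique a) (unique b)) (unique (a * b))
                          into onto injective F))
          (Σ-pairs (F ∘ multiply) (D a) (D b))
    where
    multiply : ℕ × ℕ → ℕ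
    multiply (d₁ , d₂) = d₁ * d₂
    into : ∀ {d} → d ∈ cartesianProduct (D a) (D b) → multiply d ∈ D (a * b)
    into d∈ with d₁∈ , d₂∈ ← ∈-cartesianProduct⁻ (D a) (D b) d∈ = combine 1≤a 1≤b a⊥b d₁∈ d₂∈
    onto : ∀ {d} → d ∈ D (a * b) → ∃ λ e → e ∈ cartesianProduct (D a) (D b) × multiply e ≡ d
    onto d∈ with gcd∈a , gcd∈b ← restrict 1≤a 1≤b a⊥b d∈ =
      _ , ∈-cartesianProduct⁺ gcd∈a gcd∈b , gcd-split a⊥b (member-∣ d∈)
    injective : ∀ {d e} → d ∈ cartesianProduct (D a) (D b) → e ∈ cartesianProduct (D a) (D b) →
                multiply d ≡ multiply e → d ≡ e
    injective d∈ e∈ eq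
      with d₁∈ , d₂∈ ← ∈-cartesianProduct⁻ (D a) (D b) d∈
         | e₁∈ , e₂∈ ← ∈-cartesianProduct⁻ (D a) (D b) e∈
      with refl , refl ← factor-unique a⊥b (member-∣ d₁∈) (member-∣ e₁∈) (member-∣ d₂∈) (member-∣ e₂∈) eq
      = refl

-- Convolution along a divisor system: Σ_{d ∈ D n} f(d)·g(n/d).  Dirichlet
-- convolution ⋆ and unitary convolution ⊕ are the cases D = divisors and
-- D = unitaryDivisors.
convolve : (ℕ → List ℕ) → ArithFun → ArithFun → ArithFun
convolve D f g n = Σℤ (λ d → f d *ᶻ g (quot n d)) (D n)

convolve-mult : ∀ {D f g} → DivisorSystem D → Multiplicative f → Multiplicative g →
                Multiplicative (convolve D f g)
convolve-mult {D} {f} {g} system fm gm .one rewrite DivisorSystem.at-one system | fm .one | gm .one = refl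
convolve-mult {D} {f} {g} system fm gm .mul {a} {b} 1≤a 1≤b a⊥b = begin
  convolve D f g (a * b)
    ≡⟨ Σ-split 1≤a 1≤b a⊥b (λ d → f d *ᶻ g (quot (a * b) d)) ⟩
  Σℤ (λ d₁ → Σℤ (λ d₂ → f (d₁ * d₂) *ᶻ g (quot (a * b) (d₁ * d₂))) (D b)) (D a)
    ≡⟨ Σ-cong (D a) (λ d₁∈ → Σ-cong (D b) (λ d₂∈ → term d₁∈ d₂∈)) ⟩
  Σℤ (λ d₁ → Σℤ (λ d₂ → (f d₁ *ᶻ g (quot a d₁)) *ᶻ (f d₂ *ᶻ g (quot b d₂))) (D b)) (D a)
    ≡⟨ Σ-product (λ d₁ → f d₁ *ᶻ g (quot a d₁)) (λ d₂ → f d₂ *ᶻ g (quot b d₂)) (D a) (D b) ⟨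
  convolve D f g a *ᶻ convolve D f g b ∎
  where
  open ≡-Reasoning
  open DivisorSystem system
  term : ∀ {d₁ d₂} → d₁ ∈ D a → d₂ ∈ D b →
         f (d₁ * d₂) *ᶻ g (quot (a * b) (d₁ * d₂)) ≡ (f d₁ *ᶻ g (quot a d₁)) *ᶻ (f d₂ *ᶻ g (quot b d₂))
  term {d₁} {d₂} d₁∈ d₂∈ =
    trans (cong₂ _*ᶻ_ (fm .mul 1≤d₁ 1≤d₂ (coprime-∣ a⊥b d₁∣a d₂∣b))
                      (trans (cong g (quot-mul 1≤d₁ 1≤d₂ d₁∣a d₂∣b))
                             (gm .mul (quot-pos 1≤a 1≤d₁ d₁∣a) (quot-pos 1≤b 1≤d₂ d₂∣b)
                                      (coprime-∣ a⊥b (quot-∣ 1≤d₁ d₁∣a) (quot-∣ 1≤d₂ d₂∣b)))))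
          (*ᶻ-interchange (f d₁) (f d₂) (g (quot a d₁)) (g (quot b d₂)))
    where
    d₁∣a = member-∣ d₁∈
    d₂∣b = member-∣ d₂∈
    1≤d₁ = ∣⇒pos 1≤a d₁∣a
    1≤d₂ = ∣⇒pos 1≤b d₂∣b

divisorSystem : DivisorSystem divisors
divisorSystem = record
  { unique   = unique-divisors
  ; member-∣ = proj₁ ∘ ∈divisors⁻
  ; at-one   = refl
  ; combine  = λ {a} {b} 1≤a 1≤b _ d₁∈ d₂∈ →
      ∈divisors⁺ (*-pos 1≤a 1≤b) (*-pres-∣ (proj₁ (∈divisors⁻ {n = a} d₁∈)) (proj₁ (∈divisors⁻ {n = b} d₂∈)))
  ; restrict = λ {a} {b} {d} 1≤a 1≤b _ _ →
      ∈divisors⁺ 1≤a (gcd[m,n]∣n d a) , ∈divisors⁺ 1≤b (gcd[m,n]∣n d b)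
  }

unitarySystem : DivisorSystem unitaryDivisors
unitarySystem = record
  { unique   = unique-unitary
  ; member-∣ = proj₁ ∘ ∈unitary⁻
  ; at-one   = refl
  ; combine  = combine
  ; restrict = restrict
  }
  where
  combine : ∀ {a b d₁ d₂} → 1 ≤ a → 1 ≤ b → Coprime a b →
            d₁ ∈ unitaryDivisors a → d₂ ∈ unitaryDivisors b → d₁ * d₂ ∈ unitaryDivisors (a * b)
  combine 1≤a 1≤b a⊥b d₁∈ d₂∈
    with d₁∣a , d₁⊥ , 1≤d₁ ← ∈unitary⁻ d₁∈ | d₂∣b , d₂⊥ , 1≤d₂ ← ∈unitary⁻ d₂∈ =
    ∈unitary⁺ (*-pos 1≤a 1≤b) (*-pres-∣ d₁∣a d₂∣b)
      (subst (Coprime _) (sym (quot-mul 1≤d₁ 1≤d₂ d₁∣a d₂∣b))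
        (coprime-*ˡ (coprime-*ʳ d₁⊥ (coprime-∣ a⊥b d₁∣a (quot-∣ 1≤d₂ d₂∣b)))
                    (coprime-*ʳ (coprime-∣ (Coprime.sym a⊥b) d₂∣b (quot-∣ 1≤d₁ d₁∣a)) d₂⊥)))
  restrict : ∀ {a b d} → 1 ≤ a → 1 ≤ b → Coprime a b → d ∈ unitaryDivisors (a * b) →
             gcd d a ∈ unitaryDivisors a × gcd d b ∈ unitaryDivisors b
  restrict {a} {b} {d} 1≤a 1≤b a⊥b d∈ with d∣ab , d⊥ , _ ← ∈unitary⁻ d∈ =
    ∈unitary⁺ 1≤a (gcd[m,n]∣n d a) (coprime-∣ d⊥′ (gcd[m,n]∣m d a) (m∣m*n (quot b (gcd d b)))) ,
    ∈unitary⁺ 1≤b (gcd[m,n]∣n d b) (coprime-∣ d⊥′ (gcd[m,n]∣m d b) (n∣m*n (quot a (gcd d a))))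
    where
    cofactor : quot (a * b) d ≡ quot a (gcd d a) * quot b (gcd d b)
    cofactor = trans (cong (quot (a * b)) (sym (gcd-split a⊥b d∣ab)))
                     (quot-mul (∣⇒pos 1≤a (gcd[m,n]∣n d a)) (∣⇒pos 1≤b (gcd[m,n]∣n d b))
                               (gcd[m,n]∣n d a) (gcd[m,n]∣n d b))
    d⊥′ : Coprime d (quot a (gcd d a) * quot b (gcd d b))
    d⊥′ = subst (Coprime d) cofactor d⊥

⋆-mult : ∀ {f g} → Multiplicative f → Multiplicative g → Multiplicative (f ⋆ g)
⋆-mult = convolve-mult divisorSystem

⊕-mult : ∀ {f g} → Multiplicative f → Multiplicative g → Multiplicative (f ⊕ g)
⊕-mult = convolve-mult unitarySystem

·-mult : ∀ {f g} → Multiplicative f → Multiplicative g → Multiplicative (λ n → f n *ᶻ g n)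
·-mult fm gm .one = cong₂ _*ᶻ_ (fm .one) (gm .one)
·-mult {f} {g} fm gm .mul {a} {b} 1≤a 1≤b a⊥b =
  trans (cong₂ _*ᶻ_ (fm .mul 1≤a 1≤b a⊥b) (gm .mul 1≤a 1≤b a⊥b)) (*ᶻ-interchange (f a) (f b) (g a) (g b))

idPow-mult : ∀ k → Multiplicative (idPow k)
idPow-mult k .one = cong +_ (ℕP.^-zeroˡ k)
idPow-mult k .mul {a} {b} _ _ _ = trans (cong +_ (*-^ a b k)) (ℤP.pos-* (a ^ k) (b ^ k))

∘^-mult : ∀ {f} k → Multiplicative f → Multiplicative (λ n → f (n ^ k))
∘^-mult {f} k fm .one = trans (cong f (ℕP.^-zeroˡ k)) (fm .one)
∘^-mult {f} k fm .mul {a} {b} 1≤a 1≤b a⊥b =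
  trans (cong f (*-^ a b k)) (fm .mul (^-pos k 1≤a) (^-pos k 1≤b) (coprime-^ k a⊥b))

mult-≗ : ∀ {f g} → (∀ n → f n ≡ g n) → Multiplicative f → Multiplicative g
mult-≗ {f} {g} f≗g fm .one = trans (sym (f≗g 1)) (fm .one)
mult-≗ {f} {g} f≗g fm .mul {a} {b} 1≤a 1≤b a⊥b =
  trans (sym (f≗g (a * b))) (trans (fm .mul 1≤a 1≤b a⊥b) (cong₂ _*ᶻ_ (f≗g a) (f≗g b)))

-- σ₀ = 1 ⋆ 1 is multiplicative.
σ₀-mult : Multiplicative σ₀
σ₀-mult = mult-≗ (λ n → Σ-one (divisors n)) (⋆-mult 𝟙-mult 𝟙-mult)
  where
  𝟙-mult : Multiplicative (λ _ → + 1)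
  𝟙-mult .one = refl
  𝟙-mult .mul _ _ _ = refl

prime≥2 : ∀ {p} → Prime p → 2 ≤ p
prime≥2 {p} pr = ℕ.nonTrivial⇒n>1 p {{prime⇒nonTrivial pr}}

prime-pos : ∀ {p} → Prime p → 1 ≤ p
prime-pos pr = ℕP.≤-trans (s≤s z≤n) (prime≥2 pr)

prime≢1 : ∀ {p} → Prime p → p ≢ 1
prime≢1 pr refl with s≤s () ← prime≥2 pr

p^≥2 : ∀ {p} → Prime p → ∀ e → 2 ≤ p ^ suc e
p^≥2 {p} pr e = ℕP.≤-trans (prime≥2 pr) (ℕP.m≤m*n p (p ^ e) {{ℕ.>-nonZero (^-pos e (prime-pos pr))}})

prime-coprime : ∀ {p x} → Prime p → ¬ p ∣ x → Coprime p x
prime-coprime pr p∤x (c∣p , c∣x) with prime⇒irreducible pr c∣p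
... | inj₁ c≡1 = c≡1
... | inj₂ refl = ⊥-elim (p∤x c∣x)

prime-∣-^ : ∀ {q p} → Prime q → ∀ e → q ∣ p ^ e → q ∣ p
prime-∣-^ prq zero    q∣1 = ⊥-elim (prime≢1 prq (∣1⇒≡1 q∣1))
prime-∣-^ {p = p} prq (suc e) q∣pᵉ⁺¹ with euclidsLemma p (p ^ e) prq q∣pᵉ⁺¹
... | inj₁ q∣p  = q∣p
... | inj₂ q∣pᵉ = prime-∣-^ prq e q∣pᵉ

prime-factor : ∀ n → 2 ≤ n → ∃ λ p → Prime p × p ∣ n
prime-factor n@(suc _) 2≤n with factorise n
... | record { factors = [] ; isFactorisation = refl } with s≤s () ← 2≤n
... | record { factors = p ∷ ps ; isFactorisation = eq ; factorsPrime = prp ∷ _ } =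
  p , prp , divides (product ps) (trans eq (ℕP.*-comm p _))

<-*ˡ : ∀ {a m} → 2 ≤ a → 1 ≤ m → m < a * m
<-*ˡ {a} {suc m} 2≤a _ = subst (suc m <_) (ℕP.*-comm (suc m) a) (ℕP.m<m*n (suc m) a 2≤a)

p-part : ∀ {p} → Prime p → ∀ n → 1 ≤ n → ∃ λ e → ∃ λ m → n ≡ p ^ e * m × ¬ p ∣ m × 1 ≤ m
p-part {p} pr = <-rec _ step
  where
  step : ∀ n → (∀ {n′} → n′ < n → 1 ≤ n′ → ∃ λ e → ∃ λ m → n′ ≡ p ^ e * m × ¬ p ∣ m × 1 ≤ m) →
         1 ≤ n → ∃ λ e → ∃ λ m → n ≡ p ^ e * m × ¬ p ∣ m × 1 ≤ m
  step n rec 1≤n with p ∣? n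
  ... | no p∤n = 0 , n , sym (ℕP.+-identityʳ n) , p∤n , 1≤n
  ... | yes (divides q refl) =
    let e , m , q≡pᵉm , p∤m , 1≤m = rec q<qp 1≤q
    in suc e , m , trans (cong (_* p) q≡pᵉm) (regroup (p ^ e) m p) , p∤m , 1≤m
    where
    1≤q = ∣⇒pos 1≤n (m∣m*n p)
    q<qp = subst (q <_) (ℕP.*-comm p q) (<-*ˡ (prime≥2 pr) 1≤q)
    regroup : ∀ x m p → (x * m) * p ≡ (p * x) * m
    regroup = solve-∀

mult-unique : ∀ {f g} → Multiplicative f → Multiplicative g →
              (∀ {p e} → Prime p → 1 ≤ e → f (p ^ e) ≡ g (p ^ e)) →
              ∀ n → 1 ≤ n → f n ≡ g n
mult-unique {f} {g} fm gm agree = <-rec _ step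
  where
  step : ∀ n → (∀ {m} → m < n → 1 ≤ m → f m ≡ g m) → 1 ≤ n → f n ≡ g n
  step (suc zero) _ _ = trans (fm .one) (sym (gm .one))
  step n@(suc (suc _)) rec 1≤n
    with p , pr , p∣n ← prime-factor n (s≤s (s≤s z≤n))
    with p-part pr n 1≤n
  ... | zero , m , n≡m , p∤m , _ = ⊥-elim (p∤m (subst (p ∣_) (trans n≡m (ℕP.*-identityˡ m)) p∣n))
  ... | suc e , m , n≡pᵉm , p∤m , 1≤m = begin
    f n                 ≡⟨ cong f n≡pᵉm ⟩
    f (p ^ suc e * m)   ≡⟨ fm .mul 1≤pᵉ 1≤m pᵉ⊥m ⟩
    f (p ^ suc e) *ᶻ f m ≡⟨ cong₂ _*ᶻ_ (agree {p} {suc e} pr (s≤s z≤n)) (rec m<n 1≤m) ⟩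
    g (p ^ suc e) *ᶻ g m ≡⟨ gm .mul 1≤pᵉ 1≤m pᵉ⊥m ⟨
    g (p ^ suc e * m)   ≡⟨ cong g n≡pᵉm ⟨
    g n                 ∎
    where
    open ≡-Reasoning
    1≤pᵉ = ^-pos (suc e) (prime-pos pr)
    pᵉ⊥m = coprime-^ˡ (suc e) (prime-coprime pr p∤m)
    m<n = subst (m <_) (sym n≡pᵉm) (<-*ˡ (p^≥2 pr e) 1≤m)

^-split : ∀ p {i e} → i ≤ e → p ^ e ≡ p ^ (e ∸ i) * p ^ i
^-split p {i} {e} i≤e = trans (cong (p ^_) (sym (ℕP.m∸n+n≡m i≤e))) (ℕP.^-distribˡ-+-* p (e ∸ i) i)

quot-^ : ∀ {p i e} → 1 ≤ p → i ≤ e → quot (p ^ e) (p ^ i) ≡ p ^ (e ∸ i)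
quot-^ {p} {i} 1≤p i≤e = quot-unique (^-pos i 1≤p) (^-split p i≤e)

∣p^⇒≡p^ : ∀ {p} → Prime p → ∀ e {d} → d ∣ p ^ e → ∃ λ i → i ≤ e × d ≡ p ^ i
∣p^⇒≡p^ pr zero d∣1 = 0 , z≤n , ∣1⇒≡1 d∣1
∣p^⇒≡p^ {p} pr (suc e) {d} d∣pᵉ⁺¹ with p ∣? d
... | no p∤d with i , i≤e , refl ← ∣p^⇒≡p^ pr e (Coprime.coprime-divisor (Coprime.sym (prime-coprime pr p∤d)) d∣pᵉ⁺¹)
  = i , ℕP.m≤n⇒m≤1+n i≤e , refl
... | yes (divides d′ refl)
  with i , i≤e , refl ← ∣p^⇒≡p^ pr e (*-cancelˡ-∣ p {{prime⇒nonZero pr}}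
                                        (subst (_∣ p * p ^ e) (ℕP.*-comm d′ p) d∣pᵉ⁺¹))
  = suc i , s≤s i≤e , ℕP.*-comm (p ^ i) p

^-injective : ∀ {p i j} → 2 ≤ p → p ^ i ≡ p ^ j → i ≡ j
^-injective {p} {i} {j} 2≤p eq with ℕP.<-cmp i j
... | tri< i<j _ _ = ⊥-elim (ℕP.<-irrefl eq (ℕP.^-monoʳ-< p 2≤p i<j))
... | tri≈ _ i≡j _ = i≡j
... | tri> _ _ i>j = ⊥-elim (ℕP.<-irrefl (sym eq) (ℕP.^-monoʳ-< p 2≤p i>j))

Σ-divisors-p^ : ∀ {p} → Prime p → ∀ e (F : ℕ → ℤ) →
                Σℤ F (divisors (p ^ e)) ≡ Σℤ (λ i → F (p ^ i)) (upTo (suc e))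
Σ-divisors-p^ {p} pr e F =
  sym (Σ-reindex (upTo (suc e)) (divisors (p ^ e)) (p ^_) (Unique.upTo⁺ (suc e)) (unique-divisors (p ^ e))
                 into onto (λ _ _ → ^-injective (prime≥2 pr)) F)
  where
  into : ∀ {i} → i ∈ upTo (suc e) → p ^ i ∈ divisors (p ^ e)
  into {i} i∈ = ∈divisors⁺ (^-pos e (prime-pos pr)) (divides (p ^ (e ∸ i)) (^-split p (ℕP.≤-pred (∈-upTo⁻ i∈))))
  onto : ∀ {d} → d ∈ divisors (p ^ e) → ∃ λ i → i ∈ upTo (suc e) × p ^ i ≡ d
  onto d∈ with i , i≤e , refl ← ∣p^⇒≡p^ pr e (proj₁ (∈divisors⁻ {n = p ^ e} d∈)) = i , ∈-upTo⁺ (s≤s i≤e) , refl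

count-split : ∀ {P Q R : ℕ → Set} (P? : Decidable P) (Q? : Decidable Q) (R? : Decidable R) →
              (∀ {x} → P x → Q x ⊎ R x) → (∀ {x} → Q x → P x) → (∀ {x} → R x → P x) →
              (∀ {x} → Q x → R x → ⊥) → ∀ xs →
              length (filter P? xs) ≡ length (filter Q? xs) + length (filter R? xs)
count-split P? Q? R? P⇒Q⊎R Q⇒P R⇒P disjoint [] = refl
count-split P? Q? R? P⇒Q⊎R Q⇒P R⇒P disjoint (x ∷ xs)
  with ih ← count-split P? Q? R? P⇒Q⊎R Q⇒P R⇒P disjoint xs | P? x | Q? x | R? x
... | yes _  | yes q  | yes r  = ⊥-elim (disjoint q r)
... | yes _  | yes _  | no _   = cong suc ih
... | yes _  | no _   | yes _  = trans (cong suc ih) (sym (ℕP.+-suc _ _))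
... | yes p  | no ¬q  | no ¬r  = ⊥-elim (Sum.[ ¬q , ¬r ] (P⇒Q⊎R p))
... | no ¬p  | yes q  | _      = ⊥-elim (¬p (Q⇒P q))
... | no ¬p  | no _   | yes r  = ⊥-elim (¬p (R⇒P r))
... | no _   | no _   | no _   = ih

count-range1 : ∀ {P : ℕ → Set} (P? : Decidable P) n k → (∀ {x} → P x → x ≤ n) →
               length (filter P? (range1 (n + k))) ≡ length (filter P? (range1 n))
count-range1 P? n zero    bounded = cong (λ m → length (filter P? (range1 m))) (ℕP.+-identityʳ n)
count-range1 P? n (suc k) bounded = begin
  length (filter P? (range1 (n + suc k)))
    ≡⟨ cong (λ m → length (filter P? (range1 m))) (ℕP.+-suc n k) ⟩
  length (filter P? (range1 (suc (n + k))))
    ≡⟨ cong (length ∘ filter P?) (range1-∷ʳ (n + k)) ⟩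
  length (filter P? (range1 (n + k) ++ [ suc (n + k) ]))
    ≡⟨ cong length (LP.filter-++ P? (range1 (n + k)) [ suc (n + k) ]) ⟩
  length (filter P? (range1 (n + k)) ++ filter P? [ suc (n + k) ])
    ≡⟨ LP.length-++ (filter P? (range1 (n + k))) ⟩
  length (filter P? (range1 (n + k))) + length (filter P? [ suc (n + k) ])
    ≡⟨ cong (λ l → length (filter P? (range1 (n + k))) + length l) (LP.filter-reject P? beyond) ⟩
  length (filter P? (range1 (n + k))) + 0
    ≡⟨ trans (ℕP.+-identityʳ _) (count-range1 P? n k bounded) ⟩
  length (filter P? (range1 n)) ∎
  where
  open ≡-Reasoning
  beyond = λ P[1+n+k] → ℕP.<-irrefl refl (ℕP.≤-trans (s≤s (ℕP.m≤m+n n k)) (bounded P[1+n+k]))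

count-once : ∀ y xs → Unique xs → y ∈ xs → length (filter (y ℕ.≟_) xs) ≡ 1
count-once y xs u y∈ = ℤP.+-injective (begin
  + length (filter (y ℕ.≟_) xs)  ≡⟨ Σ-ind (y ℕ.≟_) xs ⟨
  Σℤ (ind ∘ (y ℕ.≟_)) xs          ≡⟨ Σ-single (ind ∘ (y ℕ.≟_)) u y∈ (λ _ x≢y → ind-no (y ℕ.≟ _) (≢-sym x≢y)) ⟩
  ind (y ℕ.≟ y)                   ≡⟨ ind-yes (y ℕ.≟ y) refl ⟩
  + 1                             ∎)
  where open ≡-Reasoning

PrimeDivisor : ℕ → ℕ → Set
PrimeDivisor n p = Prime p × p ∣ n

primeDivisor? : ∀ n → Decidable (PrimeDivisor n)
primeDivisor? n p = prime? p ×-dec (p ∣? n)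

ω-range : ∀ {n N} → 1 ≤ n → n ≤ N → ω n ≡ length (filter (primeDivisor? n) (range1 N))
ω-range {n@(suc _)} {N} _ n≤N =
  sym (trans (cong (λ m → length (filter (primeDivisor? n) (range1 m))) (sym (ℕP.m+[n∸m]≡n n≤N)))
             (count-range1 (primeDivisor? n) n (N ∸ n) (∣⇒≤ ∘ proj₂)))

ω-mult : ∀ {a b} → 1 ≤ a → 1 ≤ b → Coprime a b → ω (a * b) ≡ ω a + ω b
ω-mult {a} {b} 1≤a 1≤b a⊥b =
  trans (count-split (primeDivisor? (a * b)) (primeDivisor? a) (primeDivisor? b)
                     split (λ (pr , p∣a) → pr , ∣m⇒∣m*n b p∣a) (λ (pr , p∣b) → pr , ∣n⇒∣m*n a p∣b)
                     (λ (pr , p∣a) (_ , p∣b) → prime≢1 pr (a⊥b (p∣a , p∣b))) (range1 (a * b)))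
        (sym (cong₂ _+_ (ω-range 1≤a (ℕP.m≤m*n a b {{ℕ.>-nonZero 1≤b}}))
                        (ω-range 1≤b (ℕP.m≤n*m b a {{ℕ.>-nonZero 1≤a}}))))
  where
  split : ∀ {p} → PrimeDivisor (a * b) p → PrimeDivisor a p ⊎ PrimeDivisor b p
  split (pr , p∣ab) with euclidsLemma a b pr p∣ab
  ... | inj₁ p∣a = inj₁ (pr , p∣a)
  ... | inj₂ p∣b = inj₂ (pr , p∣b)

ω-p^ : ∀ {p} → Prime p → ∀ e → ω (p ^ suc e) ≡ 1
ω-p^ {p} pr e =
  trans (cong length (LP.filter-≐ (primeDivisor? (p ^ suc e)) (p ℕ.≟_) onlyP (range1 (p ^ suc e))))
        (count-once p (range1 (p ^ suc e)) (unique-range1 _)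
                    (∈range1⁺ (prime-pos pr) (∣⇒≤ {{pᵉ⁺¹≢0}} (m∣m*n (p ^ e)))))
  where
  pᵉ⁺¹≢0 = ℕ.>-nonZero (^-pos (suc e) (prime-pos pr))
  onlyP : PrimeDivisor (p ^ suc e) ≐ (p ≡_)
  onlyP = (λ (prq , q∣pᵉ⁺¹) → sameAs prq (prime-∣-^ prq (suc e) q∣pᵉ⁺¹)) , λ where refl → pr , m∣m*n (p ^ e)
    where
    sameAs : ∀ {q} → Prime q → q ∣ p → p ≡ q
    sameAs prq q∣p with prime⇒irreducible pr q∣p
    ... | inj₁ q≡1 = ⊥-elim (prime≢1 prq q≡1)
    ... | inj₂ q≡p = sym q≡p

-- μ* is multiplicative, as ω is additive, and μ*(pᵉ⁺¹) = -1.
μ*-mult : Multiplicative μ*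
μ*-mult .one = refl
μ*-mult .mul {a} {b} 1≤a 1≤b a⊥b =
  trans (cong ((ℤ.- (+ 1)) ℤ.^_) (ω-mult 1≤a 1≤b a⊥b)) (ℤP.^-distribˡ-+-* (ℤ.- (+ 1)) (ω a) (ω b))

μ*-p^ : ∀ {p} → Prime p → ∀ e → μ* (p ^ suc e) ≡ -[1+ 0 ]
μ*-p^ pr e = cong ((ℤ.- (+ 1)) ℤ.^_) (ω-p^ pr e)

-- The unitary divisors of pᵉ⁺¹ are 1 and pᵉ⁺¹: for 0 < i < e + 1 the divisor
-- pⁱ shares the factor p with its cofactor pᵉ⁺¹⁻ⁱ.
Σ-unitary-p^ : ∀ {p} → Prime p → ∀ e (F : ℕ → ℤ) →
               Σℤ F (unitaryDivisors (p ^ suc e)) ≡ F 1 +ᶻ F (p ^ suc e)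
Σ-unitary-p^ {p} pr e F = begin
  Σℤ F (unitaryDivisors N)  ≡⟨ Σ-sameElements F (unique-unitary N) unique-1N (mk⇔ to from) ⟩
  F 1 +ᶻ (F N +ᶻ + 0)       ≡⟨ cong (F 1 +ᶻ_) (ℤP.+-identityʳ (F N)) ⟩
  F 1 +ᶻ F N                ∎
  where
  open ≡-Reasoning
  N = p ^ suc e
  1≤N = ^-pos (suc e) (prime-pos pr)
  unique-1N : Unique (1 ∷ N ∷ [])
  unique-1N = ((λ 1≡N → ℕP.<-irrefl 1≡N (p^≥2 pr e)) ∷ []) ∷ [] ∷ []
  from : ∀ {d} → d ∈ 1 ∷ N ∷ [] → d ∈ unitaryDivisors N
  from (here refl)         = ∈unitary⁺ 1≤N (1∣ N) (Coprime.1-coprimeTo _)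
  from (there (here refl)) = ∈unitary⁺ 1≤N ∣-refl (subst (Coprime N) (sym (quot-self 1≤N)) (Coprime.sym (Coprime.1-coprimeTo N)))
  to : ∀ {d} → d ∈ unitaryDivisors N → d ∈ 1 ∷ N ∷ []
  to d∈ with d∣N , d⊥cofactor , _ ← ∈unitary⁻ d∈ with ∣p^⇒≡p^ pr (suc e) d∣N
  ... | zero  , _   , refl = here refl
  ... | suc i , i<e+1 , refl with ℕP.<-cmp i e
  ...   | tri≈ _ refl _ = there (here refl)
  ...   | tri> _ _ i>e  = ⊥-elim (ℕP.<-irrefl refl (ℕP.≤-trans (s≤s i>e) i<e+1))
  ...   | tri< i<e _ _  = ⊥-elim (prime≢1 pr (d⊥cofactor (m∣m*n (p ^ i) , p∣cofactor)))
    where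
    p∣cofactor : p ∣ quot N (p ^ suc i)
    p∣cofactor = subst (p ∣_) (sym (quot-^ (prime-pos pr) i<e+1))
                   (subst (λ j → p ∣ p ^ j) (sym (ℕP.+-∸-assoc 1 i<e)) (m∣m*n (p ^ (e ∸ suc i))))

μ*⊕-p^ : ∀ {p} (g : ArithFun) → Prime p → ∀ e → (μ* ⊕ g) (p ^ suc e) ≡ g (p ^ suc e) -ᶻ g 1
μ*⊕-p^ {p} g pr e = begin
  (μ* ⊕ g) N
    ≡⟨ Σ-unitary-p^ pr e (λ d → μ* d *ᶻ g (quot N d)) ⟩
  + 1 *ᶻ g (quot N 1) +ᶻ μ* N *ᶻ g (quot N N)
    ≡⟨ cong₂ (λ x y → + 1 *ᶻ g x +ᶻ μ* N *ᶻ g y) (n/1≡n N) (quot-self 1≤N) ⟩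
  + 1 *ᶻ g N +ᶻ μ* N *ᶻ g 1
    ≡⟨ cong (λ s → + 1 *ᶻ g N +ᶻ s *ᶻ g 1) (μ*-p^ pr e) ⟩
  + 1 *ᶻ g N +ᶻ -[1+ 0 ] *ᶻ g 1
    ≡⟨ simplify (g N) (g 1) ⟩
  g N -ᶻ g 1 ∎
  where
  open ≡-Reasoning
  N = p ^ suc e
  1≤N = ^-pos (suc e) (prime-pos pr)
  simplify : ∀ x y → + 1 *ᶻ x +ᶻ ℤ.- + 1 *ᶻ y ≡ x -ᶻ y
  simplify = ℤSolver.solve-∀

φ*-mult : Multiplicative φ*
φ*-mult = ⊕-mult μ*-mult (idPow-mult 1)

φ*-p^ : ∀ {p} → Prime p → ∀ e → φ* (p ^ suc e) ≡ + p ^ suc e -ᶻ + 1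
φ*-p^ {p} pr e = trans (μ*⊕-p^ (idPow 1) pr e) (cong (λ m → + m -ᶻ + 1) (ℕP.*-identityʳ (p ^ suc e)))

-- Second identity: J*ₖ(n) = φ*(nᵏ).  Both sides are multiplicative, and at
-- n = pᵉ⁺¹ both equal p^((e+1)k) - 1.
J*≡φ*∘^ : ∀ k n → k ≥ 1 → n ≥ 1 → J* k n ≡ φ* (n ^ k)
J*≡φ*∘^ k@(suc k′) n _ = mult-unique (⊕-mult μ*-mult (idPow-mult k)) (∘^-mult k φ*-mult) atPrimePower n
  where
  atPrimePower : ∀ {p e} → Prime p → 1 ≤ e → J* k (p ^ e) ≡ φ* ((p ^ e) ^ k)
  atPrimePower {p} {suc e} pr _ = begin
    J* k (p ^ suc e)                       ≡⟨ μ*⊕-p^ (idPow k) pr e ⟩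
    + (p ^ suc e) ^ k -ᶻ + 1 ^ k           ≡⟨ cong₂ (λ x y → + x -ᶻ + y) (ℕP.^-*-assoc p (suc e) k) (ℕP.^-zeroˡ k) ⟩
    + p ^ (suc e * k) -ᶻ + 1               ≡⟨ φ*-p^ pr (k′ + e * k) ⟨
    φ* (p ^ (suc e * k))                   ≡⟨ cong φ* (ℕP.^-*-assoc p (suc e) k) ⟨
    φ* ((p ^ suc e) ^ k)                   ∎
    where open ≡-Reasoning

partition-count : (key : A → ℕ) (D : List ℕ) → Unique D → (xs : List A) →
                  (∀ {x} → x ∈ xs → key x ∈ D) →
                  + length xs ≡ Σℤ (λ g → + length (filter (λ x → key x ℕ.≟ g) xs)) D
partition-count key D uD xs keyed = begin
  + length xs                                             ≡⟨ Σ-one xs ⟨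
  Σℤ (λ _ → + 1) xs                                       ≡⟨ Σ-cong xs (λ x∈ → sym (oneKey x∈)) ⟩
  Σℤ (λ x → Σℤ (λ g → ind (key x ℕ.≟ g)) D) xs           ≡⟨ Σ-swap (λ x g → ind (key x ℕ.≟ g)) xs D ⟩
  Σℤ (λ g → Σℤ (λ x → ind (key x ℕ.≟ g)) xs) D           ≡⟨ Σ-cong D (λ {g} _ → Σ-ind (key-is g) xs) ⟩
  Σℤ (λ g → + length (filter (λ x → key x ℕ.≟ g) xs)) D  ∎
  where
  open ≡-Reasoning
  key-is : ∀ g → Decidable (λ x → key x ≡ g)
  key-is g x = key x ℕ.≟ g
  oneKey : ∀ {x} → x ∈ xs → Σℤ (λ g → ind (key x ℕ.≟ g)) D ≡ + 1
  oneKey {x} x∈ = trans (Σ-ind (key x ℕ.≟_) D) (cong +_ (count-once (key x) D uD (keyed x∈)))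

gcd-*ʳ : ∀ j q g → gcd (j * g) (q * g) ≡ g * gcd j q
gcd-*ʳ j q g = trans (cong₂ gcd (ℕP.*-comm j g) (ℕP.*-comm q g)) (sym (c*gcd[m,n]≡gcd[cm,cn] g j q))

-- For g ∣ n, the m ∈ [1..n] with gcd(m, n) = g are the j·g with j ∈ [1..n/g]
-- coprime to n/g; so there are φ(n/g) of them.
gcd-class : ∀ {n g} → 1 ≤ n → g ∈ divisors n →
            + length (filter (λ m → gcd m n ℕ.≟ g) (range1 n)) ≡ φ (quot n g)
gcd-class {n} {g} 1≤n g∈ with g∣n , 1≤g ← ∈divisors⁻ g∈ = begin
  + length withGcd-g           ≡⟨ Σ-one withGcd-g ⟨
  Σℤ (λ _ → + 1) withGcd-g     ≡⟨ Σ-reindex coprimeToQ withGcd-g (_* g) uniqueCoprime uniqueGcd into onto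
                                            (λ _ _ → ℕP.*-cancelʳ-≡ _ _ g {{g≢0}}) (λ _ → + 1) ⟨
  Σℤ (λ _ → + 1) coprimeToQ    ≡⟨ Σ-one coprimeToQ ⟩
  φ q                          ∎
  where
  open ≡-Reasoning
  q = quot n g
  g≢0 = ℕ.>-nonZero 1≤g
  q*g≡n : q * g ≡ n
  q*g≡n = quot-* 1≤g g∣n
  withGcd-g = filter (λ m → gcd m n ℕ.≟ g) (range1 n)
  coprimeToQ = filter (λ j → coprime? j q) (range1 q)
  uniqueCoprime = Unique.filter⁺ (λ j → coprime? j q) (unique-range1 q)
  uniqueGcd = Unique.filter⁺ (λ m → gcd m n ℕ.≟ g) (unique-range1 n)
  into : ∀ {j} → j ∈ coprimeToQ → j * g ∈ withGcd-g
  into {j} j∈ with j∈range , j⊥q ← ∈-filter⁻ (λ j → coprime? j q) {xs = range1 q} j∈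
              with 1≤j , j≤q ← ∈range1⁻ j∈range =
    ∈-filter⁺ (λ m → gcd m n ℕ.≟ g)
      (∈range1⁺ (*-pos 1≤j 1≤g) (subst (j * g ≤_) q*g≡n (ℕP.*-monoˡ-≤ g j≤q)))
      (begin
        gcd (j * g) n        ≡⟨ cong (gcd (j * g)) q*g≡n ⟨
        gcd (j * g) (q * g)  ≡⟨ gcd-*ʳ j q g ⟩
        g * gcd j q          ≡⟨ cong (g *_) (Coprime.coprime⇒gcd≡1 j⊥q) ⟩
        g * 1                ≡⟨ ℕP.*-identityʳ g ⟩
        g                    ∎)
  onto : ∀ {m} → m ∈ withGcd-g → ∃ λ j → j ∈ coprimeToQ × j * g ≡ m
  onto {m} m∈ with m∈range , gcd≡g ← ∈-filter⁻ (λ m → gcd m n ℕ.≟ g) {xs = range1 n} m∈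
              with 1≤m , m≤n ← ∈range1⁻ m∈range
              with divides j refl ← subst (_∣ m) gcd≡g (gcd[m,n]∣m m n) =
    j , ∈-filter⁺ (λ j → coprime? j q) (∈range1⁺ 1≤j j≤q) j⊥q , refl
    where
    1≤j = ∣⇒pos 1≤m (m∣m*n g)
    j≤q = ℕP.*-cancelʳ-≤ j q g {{g≢0}} (subst (j * g ≤_) (sym q*g≡n) m≤n)
    j⊥q : Coprime j q
    j⊥q = Coprime.gcd≡1⇒coprime (ℕP.*-cancelˡ-≡ (gcd j q) 1 g {{g≢0}} (begin
      g * gcd j q          ≡⟨ gcd-*ʳ j q g ⟨
      gcd (j * g) (q * g)  ≡⟨ cong (gcd (j * g)) q*g≡n ⟩
      gcd (j * g) n        ≡⟨ gcd≡g ⟩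
      g                    ≡⟨ ℕP.*-identityʳ g ⟨
      g * 1                ∎))

gauss-cofactor : ∀ n → 1 ≤ n → Σℤ (λ g → φ (quot n g)) (divisors n) ≡ + n
gauss-cofactor n 1≤n = begin
  Σℤ (λ g → φ (quot n g)) (divisors n)
    ≡⟨ Σ-cong (divisors n) (λ g∈ → sym (gcd-class 1≤n g∈)) ⟩
  Σℤ (λ g → + length (filter (λ m → gcd m n ℕ.≟ g) (range1 n))) (divisors n)
    ≡⟨ partition-count (λ m → gcd m n) (divisors n) (unique-divisors n) (range1 n)
                       (λ {m} _ → ∈divisors⁺ 1≤n (gcd[m,n]∣n m n)) ⟨
  + length (range1 n)
    ≡⟨ cong +_ (trans (LP.length-map suc (upTo n)) (LP.length-upTo n)) ⟩
  + n ∎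
  where open ≡-Reasoning

-- … and then, as g ↦ n/g permutes the divisors of n, Σ_{d ∣ n} φ(d) = n.
gauss : ∀ n → 1 ≤ n → Σℤ φ (divisors n) ≡ + n
gauss n 1≤n = trans (sym (Σ-reindex (divisors n) (divisors n) (quot n) (unique-divisors n) (unique-divisors n)
                                    into onto injective φ))
                    (gauss-cofactor n 1≤n)
  where
  into : ∀ {g} → g ∈ divisors n → quot n g ∈ divisors n
  into g∈ with g∣n , 1≤g ← ∈divisors⁻ g∈ = ∈divisors⁺ 1≤n (quot-∣ 1≤g g∣n)
  onto : ∀ {d} → d ∈ divisors n → ∃ λ g → g ∈ divisors n × quot n g ≡ d
  onto {d} d∈ with d∣n , 1≤d ← ∈divisors⁻ d∈ = quot n d , into d∈ , quot-quot 1≤n 1≤d d∣n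
  injective : ∀ {g g′} → g ∈ divisors n → g′ ∈ divisors n → quot n g ≡ quot n g′ → g ≡ g′
  injective g∈ g′∈ eq with g∣n , 1≤g ← ∈divisors⁻ g∈ | g′∣n , 1≤g′ ← ∈divisors⁻ g′∈ =
    trans (sym (quot-quot 1≤n 1≤g g∣n)) (trans (cong (quot n) eq) (quot-quot 1≤n 1≤g′ g′∣n))

φ-defect : ℕ → ℕ → ℤ
φ-defect x y = φ (x * y) -ᶻ φ x *ᶻ φ y

-- For coprime a, b the defects over d₁ ∣ a, d₂ ∣ b sum to a·b - a·b = 0, by
-- Gauss' identity for a·b, a and b.
Σ-φ-defect : ∀ {a b} → 1 ≤ a → 1 ≤ b → Coprime a b →
             Σℤ (λ d₁ → Σℤ (φ-defect d₁) (divisors b)) (divisors a) ≡ + 0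
Σ-φ-defect {a} {b} 1≤a 1≤b a⊥b = begin
  Σℤ (λ d₁ → Σℤ (φ-defect d₁) (divisors b)) (divisors a)
    ≡⟨ Σ-cong (divisors a) (λ {d₁} _ → Σ-- (λ d₂ → φ (d₁ * d₂)) (λ d₂ → φ d₁ *ᶻ φ d₂) (divisors b)) ⟩
  Σℤ (λ d₁ → Σℤ (λ d₂ → φ (d₁ * d₂)) (divisors b) -ᶻ Σℤ (λ d₂ → φ d₁ *ᶻ φ d₂) (divisors b)) (divisors a)
    ≡⟨ Σ-- _ _ (divisors a) ⟩
  Σℤ (λ d₁ → Σℤ (λ d₂ → φ (d₁ * d₂)) (divisors b)) (divisors a)
    -ᶻ Σℤ (λ d₁ → Σℤ (λ d₂ → φ d₁ *ᶻ φ d₂) (divisors b)) (divisors a)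
    ≡⟨ cong₂ _-ᶻ_ (DivisorSystem.Σ-split divisorSystem 1≤a 1≤b a⊥b φ) (Σ-product φ φ (divisors a) (divisors b)) ⟨
  Σℤ φ (divisors (a * b)) -ᶻ Σℤ φ (divisors a) *ᶻ Σℤ φ (divisors b)
    ≡⟨ cong₂ _-ᶻ_ (gauss (a * b) (*-pos 1≤a 1≤b)) (cong₂ _*ᶻ_ (gauss a 1≤a) (gauss b 1≤b)) ⟩
  + (a * b) -ᶻ + a *ᶻ + b
    ≡⟨ cong (+ (a * b) -ᶻ_) (ℤP.pos-* a b) ⟨
  + (a * b) -ᶻ + (a * b)
    ≡⟨ ℤP.+-inverseʳ (+ (a * b)) ⟩
  + 0 ∎
  where open ≡-Reasoning

-- φ is multiplicative: by strong induction on a·b every defect at a pair of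
-- divisors other than (a, b) vanishes, so the vanishing sum above is the
-- defect at (a, b) alone.
φ-mult : Multiplicative φ
φ-mult .one = refl
φ-mult .mul {a} {b} 1≤a 1≤b a⊥b = ℤP.i-j≡0⇒i≡j _ _ (<-rec Vanishes step (a * b) refl 1≤a 1≤b a⊥b)
  where
  Vanishes : ℕ → Set
  Vanishes n = ∀ {a b} → a * b ≡ n → 1 ≤ a → 1 ≤ b → Coprime a b → φ-defect a b ≡ + 0
  step : ∀ n → (∀ {m} → m < n → Vanishes m) → Vanishes n
  step _ rec {a} {b} refl 1≤a 1≤b a⊥b = begin
    φ-defect a b                                              ≡⟨ Σ-single (φ-defect a) (unique-divisors b) b∈ innerZero ⟨
    Σℤ (φ-defect a) (divisors b)                              ≡⟨ Σ-single (λ d₁ → Σℤ (φ-defect d₁) (divisors b))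
                                                                          (unique-divisors a) a∈ outerZero ⟨
    Σℤ (λ d₁ → Σℤ (φ-defect d₁) (divisors b)) (divisors a)    ≡⟨ Σ-φ-defect 1≤a 1≤b a⊥b ⟩
    + 0                                                       ∎
    where
    open ≡-Reasoning
    a∈ = ∈divisors⁺ 1≤a ∣-refl
    b∈ = ∈divisors⁺ 1≤b ∣-refl
    b≢0 = ℕ.>-nonZero 1≤b
    smaller : ∀ {d₁ d₂} → d₁ ∈ divisors a → d₂ ∈ divisors b → d₁ * d₂ < a * b → φ-defect d₁ d₂ ≡ + 0
    smaller d₁∈ d₂∈ lt with d₁∣a , 1≤d₁ ← ∈divisors⁻ d₁∈ | d₂∣b , 1≤d₂ ← ∈divisors⁻ d₂∈ =
      rec lt refl 1≤d₁ 1≤d₂ (coprime-∣ a⊥b d₁∣a d₂∣b)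
    innerZero : ∀ {d₂} → d₂ ∈ divisors b → d₂ ≢ b → φ-defect a d₂ ≡ + 0
    innerZero d₂∈ d₂≢b =
      smaller a∈ d₂∈ (ℕP.*-monoʳ-< a {{ℕ.>-nonZero 1≤a}} (∣∧≢⇒< 1≤b (proj₁ (∈divisors⁻ d₂∈)) d₂≢b))
    outerZero : ∀ {d₁} → d₁ ∈ divisors a → d₁ ≢ a → Σℤ (φ-defect d₁) (divisors b) ≡ + 0
    outerZero {d₁} d₁∈ d₁≢a = Σ-zero (divisors b) (λ {d₂} d₂∈ → smaller d₁∈ d₂∈
      (ℕP.≤-<-trans (ℕP.*-monoʳ-≤ d₁ (∣⇒≤ {{b≢0}} (proj₁ (∈divisors⁻ d₂∈))))          -- d₁d₂ ≤ d₁b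
                    (ℕP.*-monoˡ-< b {{b≢0}} (∣∧≢⇒< 1≤a (proj₁ (∈divisors⁻ d₁∈)) d₁≢a))))  -- d₁b < ab

module AtPrimePower {p : ℕ} (pr : Prime p) where

  1≤p : 1 ≤ p
  1≤p = prime-pos pr

  Σφ-p^ : ∀ j → Σℤ (λ i → φ (p ^ i)) (upTo (suc j)) ≡ + p ^ j
  Σφ-p^ j = trans (sym (Σ-divisors-p^ pr j φ)) (gauss (p ^ j) (^-pos j 1≤p))

  -- φ(pʲ⁺¹) = pʲ⁺¹ - pʲ: the difference of Gauss' identity for pʲ⁺¹ and pʲ.
  φ-p^ : ∀ j → φ (p ^ suc j) ≡ + p ^ suc j -ᶻ + p ^ j
  φ-p^ j = begin
    φ (p ^ suc j)                                       ≡⟨ cancel (+ p ^ j) (φ (p ^ suc j)) ⟩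
    + p ^ j +ᶻ (φ (p ^ suc j) +ᶻ + 0) -ᶻ + p ^ j        ≡⟨ cong (_-ᶻ + p ^ j) consecutive ⟩
    + p ^ suc j -ᶻ + p ^ j                              ∎
    where
    open ≡-Reasoning
    cancel : ∀ x y → y ≡ x +ᶻ (y +ᶻ + 0) -ᶻ x
    cancel = ℤSolver.solve-∀
    consecutive : + p ^ j +ᶻ (φ (p ^ suc j) +ᶻ + 0) ≡ + p ^ suc j
    consecutive = begin
      + p ^ j +ᶻ (φ (p ^ suc j) +ᶻ + 0)                 ≡⟨ cong (_+ᶻ (φ (p ^ suc j) +ᶻ + 0)) (Σφ-p^ j) ⟨
      Σℤ (λ i → φ (p ^ i)) (upTo (suc j)) +ᶻ (φ (p ^ suc j) +ᶻ + 0)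
                                                        ≡⟨ Σ-++ (λ i → φ (p ^ i)) (upTo (suc j)) [ suc j ] ⟨
      Σℤ (λ i → φ (p ^ i)) (upTo (suc j) ++ [ suc j ])  ≡⟨ cong (Σℤ (λ i → φ (p ^ i))) (LP.upTo-∷ʳ (suc j)) ⟩
      Σℤ (λ i → φ (p ^ i)) (upTo (suc (suc j)))         ≡⟨ Σφ-p^ (suc j) ⟩
      + p ^ suc j                                       ∎

  ^*φ-p^ : ∀ i j → + p ^ i *ᶻ φ (p ^ suc j) ≡ φ (p ^ (i + suc j))
  ^*φ-p^ i j = begin
    + p ^ i *ᶻ φ (p ^ suc j)                          ≡⟨ cong (+ p ^ i *ᶻ_) (φ-p^ j) ⟩
    + p ^ i *ᶻ (+ p ^ suc j -ᶻ + p ^ j)               ≡⟨ distrib (+ p ^ i) (+ p ^ suc j) (+ p ^ j) ⟩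
    + p ^ i *ᶻ + p ^ suc j -ᶻ + p ^ i *ᶻ + p ^ j      ≡⟨ cong₂ _-ᶻ_ (P-+ i (suc j)) (P-+ i j) ⟨
    + p ^ (i + suc j) -ᶻ + p ^ (i + j)                ≡⟨ cong (λ k → + p ^ k -ᶻ + p ^ (i + j)) (ℕP.+-suc i j) ⟩
    + p ^ suc (i + j) -ᶻ + p ^ (i + j)                ≡⟨ φ-p^ (i + j) ⟨
    φ (p ^ suc (i + j))                               ≡⟨ cong (λ k → φ (p ^ k)) (ℕP.+-suc i j) ⟨
    φ (p ^ (i + suc j))                               ∎
    where
    open ≡-Reasoning
    distrib : ∀ x y z → x *ᶻ (y -ᶻ z) ≡ x *ᶻ y -ᶻ x *ᶻ z
    distrib = ℤSolver.solve-∀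
    P-+ : ∀ x y → + p ^ (x + y) ≡ + p ^ x *ᶻ + p ^ y
    P-+ x y = trans (cong +_ (ℕP.^-distribˡ-+-* p x y)) (ℤP.pos-* (p ^ x) (p ^ y))

  -- (id ⋆ φ)(pᵉ) = e·φ(pᵉ) + pᵉ: each of the terms pⁱ·φ(pᵉ⁻ⁱ), i < e, is φ(pᵉ).
  id⋆φ-p^ : ∀ e → Σℤ (λ d → + d *ᶻ φ (quot (p ^ e) d)) (divisors (p ^ e)) ≡ + e *ᶻ φ (p ^ e) +ᶻ + p ^ e
  id⋆φ-p^ e = begin
    Σℤ (λ d → + d *ᶻ φ (quot (p ^ e) d)) (divisors (p ^ e))
      ≡⟨ Σ-divisors-p^ pr e (λ d → + d *ᶻ φ (quot (p ^ e) d)) ⟩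
    Σℤ (λ i → + p ^ i *ᶻ φ (quot (p ^ e) (p ^ i))) (upTo (suc e))
      ≡⟨ Σ-cong (upTo (suc e)) (λ {i} i∈ → cong (λ m → + p ^ i *ᶻ φ m)
                                               (quot-^ 1≤p (ℕP.≤-pred (∈-upTo⁻ i∈)))) ⟩
    Σℤ term (upTo (suc e))
      ≡⟨ cong (Σℤ term) (LP.upTo-∷ʳ e) ⟨
    Σℤ term (upTo e ++ [ e ])
      ≡⟨ Σ-++ term (upTo e) [ e ] ⟩
    Σℤ term (upTo e) +ᶻ (term e +ᶻ + 0)
      ≡⟨ cong₂ _+ᶻ_ (trans (Σ-cong (upTo e) (below ∘ ∈-upTo⁻)) (Σ-const (φ (p ^ e)) (upTo e))) top ⟩
    + length (upTo e) *ᶻ φ (p ^ e) +ᶻ + p ^ e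
      ≡⟨ cong (λ l → + l *ᶻ φ (p ^ e) +ᶻ + p ^ e) (LP.length-upTo e) ⟩
    + e *ᶻ φ (p ^ e) +ᶻ + p ^ e
      ∎
    where
    open ≡-Reasoning
    term : ℕ → ℤ
    term i = + p ^ i *ᶻ φ (p ^ (e ∸ i))
    below : ∀ {i} → i < e → term i ≡ φ (p ^ e)
    below {i} i<e = begin
      + p ^ i *ᶻ φ (p ^ (e ∸ i))                ≡⟨ cong (λ k → + p ^ i *ᶻ φ (p ^ k)) (ℕP.+-∸-assoc 1 i<e) ⟩
      + p ^ i *ᶻ φ (p ^ suc (e ∸ suc i))        ≡⟨ ^*φ-p^ i (e ∸ suc i) ⟩
      φ (p ^ (i + suc (e ∸ suc i)))             ≡⟨ cong (λ k → φ (p ^ k)) (trans (ℕP.+-suc i _) (ℕP.m+[n∸m]≡n i<e)) ⟩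
      φ (p ^ e)                                 ∎
    top : term e +ᶻ + 0 ≡ + p ^ e
    top = trans (ℤP.+-identityʳ (term e))
                (trans (cong (λ k → + p ^ e *ᶻ φ (p ^ k)) (ℕP.n∸n≡0 e)) (ℤP.*-identityʳ (+ p ^ e)))

  φ*-shape : ∀ {e d} → d ∈ divisors (p ^ e) → φ* d ≡ + d -ᶻ + 1 +ᶻ ind (d ℕ.≟ 1)
  φ*-shape {e} d∈ with ∣p^⇒≡p^ pr e (proj₁ (∈divisors⁻ {n = p ^ e} d∈))
  ... | zero  , _ , refl = refl
  ... | suc i , _ , refl = begin
    φ* (p ^ suc i)                               ≡⟨ φ*-p^ pr i ⟩
    + p ^ suc i -ᶻ + 1                           ≡⟨ ℤP.+-identityʳ _ ⟨
    + p ^ suc i -ᶻ + 1 +ᶻ + 0                    ≡⟨ cong (+ p ^ suc i -ᶻ + 1 +ᶻ_) (ind-no (p ^ suc i ℕ.≟ 1) pᵉ≢1) ⟨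
    + p ^ suc i -ᶻ + 1 +ᶻ ind (p ^ suc i ℕ.≟ 1)  ∎
    where
    open ≡-Reasoning
    pᵉ≢1 : p ^ suc i ≢ 1
    pᵉ≢1 pᵉ≡1 = ℕP.<-irrefl (sym pᵉ≡1) (p^≥2 pr i)

  σ₀-p^ : ∀ e → σ₀ (p ^ e) ≡ + suc e
  σ₀-p^ e = begin
    + length (divisors (p ^ e))          ≡⟨ Σ-one (divisors (p ^ e)) ⟨
    Σℤ (λ _ → + 1) (divisors (p ^ e))    ≡⟨ Σ-divisors-p^ pr e (λ _ → + 1) ⟩
    Σℤ (λ _ → + 1) (upTo (suc e))        ≡⟨ Σ-one (upTo (suc e)) ⟩
    + length (upTo (suc e))              ≡⟨ cong +_ (LP.length-upTo (suc e)) ⟩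
    + suc e                              ∎
    where open ≡-Reasoning

  -- (φ* ⋆ φ)(pᵉ) = (id ⋆ φ)(pᵉ) - Σ_{d ∣ pᵉ} φ(pᵉ/d) + φ(pᵉ)
  --             = (e·φ(pᵉ) + pᵉ) - pᵉ + φ(pᵉ) = σ₀(pᵉ)·φ(pᵉ).
  φ*⋆φ-p^ : ∀ e → (φ* ⋆ φ) (p ^ e) ≡ σ₀ (p ^ e) *ᶻ φ (p ^ e)
  φ*⋆φ-p^ e = begin
    (φ* ⋆ φ) n
      ≡⟨ Σ-cong (divisors n) (λ {d} d∈ → trans (cong (_*ᶻ φ (quot n d)) (φ*-shape {e} d∈))
                                               (distrib (+ d) (ind (d ℕ.≟ 1)) (φ (quot n d)))) ⟩
    Σℤ (λ d → (+ d *ᶻ φ (quot n d) -ᶻ φ (quot n d)) +ᶻ ind (d ℕ.≟ 1) *ᶻ φ (quot n d)) (divisors n)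
      ≡⟨ Σ-+ _ (λ d → ind (d ℕ.≟ 1) *ᶻ φ (quot n d)) (divisors n) ⟩
    Σℤ (λ d → + d *ᶻ φ (quot n d) -ᶻ φ (quot n d)) (divisors n)
      +ᶻ Σℤ (λ d → ind (d ℕ.≟ 1) *ᶻ φ (quot n d)) (divisors n)
      ≡⟨ cong₂ _+ᶻ_ (Σ-- (λ d → + d *ᶻ φ (quot n d)) (λ d → φ (quot n d)) (divisors n))
                    (Σ-single (λ d → ind (d ℕ.≟ 1) *ᶻ φ (quot n d)) (unique-divisors n) 1∈ notOne) ⟩
    (Σℤ (λ d → + d *ᶻ φ (quot n d)) (divisors n) -ᶻ Σℤ (λ d → φ (quot n d)) (divisors n)) +ᶻ + 1 *ᶻ φ (quot n 1)
      ≡⟨ cong₂ (λ x y → (x -ᶻ y) +ᶻ + 1 *ᶻ φ (quot n 1)) (id⋆φ-p^ e) (gauss-cofactor n 1≤n) ⟩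
    (+ e *ᶻ φ n +ᶻ + n -ᶻ + n) +ᶻ + 1 *ᶻ φ (quot n 1)
      ≡⟨ cong (λ m → (+ e *ᶻ φ n +ᶻ + n -ᶻ + n) +ᶻ + 1 *ᶻ φ m) (n/1≡n n) ⟩
    (+ e *ᶻ φ n +ᶻ + n -ᶻ + n) +ᶻ + 1 *ᶻ φ n
      ≡⟨ collect (+ e) (φ n) (+ n) ⟩
    + suc e *ᶻ φ n
      ≡⟨ cong (_*ᶻ φ n) (σ₀-p^ e) ⟨
    σ₀ n *ᶻ φ n ∎
    where
    open ≡-Reasoning
    n = p ^ e
    1≤n = ^-pos e 1≤p
    1∈ = ∈divisors⁺ 1≤n (1∣ n)
    notOne : ∀ {d} → d ∈ divisors n → d ≢ 1 → ind (d ℕ.≟ 1) *ᶻ φ (quot n d) ≡ + 0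
    notOne {d} _ d≢1 = cong (_*ᶻ φ (quot n d)) (ind-no (d ℕ.≟ 1) d≢1)
    distrib : ∀ x δ y → (x -ᶻ + 1 +ᶻ δ) *ᶻ y ≡ (x *ᶻ y -ᶻ y) +ᶻ δ *ᶻ y
    distrib = ℤSolver.solve-∀
    collect : ∀ e y m → (e *ᶻ y +ᶻ m -ᶻ m) +ᶻ + 1 *ᶻ y ≡ (+ 1 +ᶻ e) *ᶻ y
    collect = ℤSolver.solve-∀

φ*⋆φ≡σ₀·φ : ∀ n → n ≥ 1 → (φ* ⋆ φ) n ≡ σ₀ n *ᶻ φ n
φ*⋆φ≡σ₀·φ = mult-unique (⋆-mult φ*-mult φ-mult) (·-mult σ₀-mult φ-mult)
                        (λ {p} {e} pr _ → AtPrimePower.φ*⋆φ-p^ pr e)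

mainTheorem9 : ((n : ℕ) → n ≥ 1 → (φ* ⋆ φ) n ≡ σ₀ n ℤ.* φ n)
               × ((k n : ℕ) → k ≥ 1 → n ≥ 1 → J* k n ≡ φ* (n ^ k))
mainTheorem9 = φ*⋆φ≡σ₀·φ , J*≡φ*∘^
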